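{- Let $\lambda\in\mathbf{k}$. The triple $(\mathrm{ADF},\Delta,\epsilon)$ is a twisted coalgebra.
   Context: $\mathbf{k}$ is a field of characteristic zero. Species: functors from finite sets with bijections to $\mathbf{k}$-vector spaces; Cauchy product $(P\otimes Q)[X]=\bigoplus_{X_1\sqcup X_2=X}P[X_1]\otimes Q[X_2]$; $1_{\mathbf{k}}$ is the species with $1_{\mathbf{k}}[\emptyset]=\mathbf{k}$, $1_{\mathbf{k}}[X]=0$ otherwise. A twisted coalgebra is a species $P$ with morphisms $\Delta:P\to P\otimes P$ and $\varepsilon:P\to1_{\mathbf{k}}$ such that $(\Delta\otimes\mathrm{id})\circ\Delta=(\mathrm{id}\otimes\Delta)\circ\Delta$ and $(\varepsilon\otimes\mathrm{id})\circ\Delta=\mathrm{id}=(\mathrm{id}\otimes\varepsilon)\circ\Delta$. A twisted algebra is a species with natural, associative, unital products; a Rota–Baxter species of weight $\lambda$ is a twisted algebra with a morphism $R$ satisfying $m_{X,Y}(R_Xx\otimes R_Yy)=R_{X\sqcup Y}m_{X,Y}(R_Xx\otimes y+x\otimes R_Yy+\lambda x\otimes y)$; morphisms of Rota–Baxter species preserve product, unit and operator. For a finite set $X$, $\mathrm{ADF}[X]$ has basis the planar rooted forests with exactly $|X|$ angles (gaps between consecutive leaves, inside a tree or between adjacent trees) decorated bijectively by $X$, written $T_1x_1\cdots x_mT_{m+1}$; $\bullet$ is the one-vertex tree and $\bullet x\bullet$ is two one-vertex trees separated by an angle decorated $x$. $R_X=B^+$ adds a new root joined to all roots. The product $\diamond$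 (weight $\lambda$) is defined bilinearly by induction on depth: for trees $\bullet\diamond T'=T'$, $T\diamond\bullet=T$, $B^+(A)\diamond B^+(A')=B^+(B^+(A)\diamond A')+B^+(A\diamond B^+(A'))+\lambda B^+(A\diamond A')$; for forests $F\diamond G=T_1x_1\cdots x_m(T_{m+1}\diamond T'_1)y_1\cdots y_nT'_{n+1}$. $(\mathrm{ADF},\diamond,\bullet,B^+)$ is the free Rota–Baxter species of weight $\lambda$ on the species $O$ with $O[\{x\}]=\mathbf{k}\bullet x\bullet$ and $O[X]=0$ for non-singletons. $\epsilon:\mathrm{ADF}\to1_{\mathbf{k}}$: $\epsilon_\emptyset(\bullet)=1$, $\epsilon_X(F)=0$ for all other basis forests. $\mathrm{ADF}\otimes\mathrm{ADF}$ is the Rota–Baxter species with componentwise product $(F_1\diamond F_2)\otimes(G_1\diamond G_2)$ and operator $R^{(2)}_X(F\otimes G)=B^+(F)\otimes G+\epsilon_{X_1}(F)\bullet\otimes B^+(G)$ for $F\in\mathrm{ADF}[X_1]$, $G\in\mathrm{ADF}[X\setminus X_1]$. $\Delta:\mathrm{ADF}\to\mathrm{ADF}\otimes\mathrm{ADF}$ is the unique morphism of Rota–Baxter species with $\Delta_{\{x\}}(\bullet x\bullet)=\bullet x\bullet\otimes\bullet+\bullet\otimes\bullet x\bullet$ for every singleton $\{x\}$. -}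

module Defs where

open import Level using (Level; _⊔_)
open import Data.Nat as ℕ using (ℕ; zero; suc)
open import Data.Product using (Σ; ∃; _×_; _,_; proj₁; proj₂)
open import Data.List using (List; []; _∷_; _++_; map; concatMap)
open import Data.List.Relation.Unary.All using (All)
open import Data.List.Relation.Unary.Unique.Propositional using (Unique)
open import Data.List.Relation.Binary.Permutation.Propositional using (_↭_)
open import Relation.Binary.PropositionalEquality using (_≡_; refl; cong; cong₂)
open import Relation.Binary.Definitions using (DecidableEquality)
open import Relation.Nullary using (¬_; Dec; yes; no)
open import Relation.Nullary.Decidable using (map′; _×-dec_)
open import Function.Bundles using (_↔_; Inverse)
open import Algebra.Bundles using (CommutativeRing)

record IsField {c ℓ} (K : CommutativeRing c ℓ) : Set (c ⊔ ℓ) where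
  open CommutativeRing K
  field
    0≉1     : ¬ (0# ≈ 1#)
    inverse : ∀ x → ¬ (x ≈ 0#) → ∃ λ y → (x * y) ≈ 1#

module _ {c ℓ} (K : CommutativeRing c ℓ) where
  open CommutativeRing K
  natK : ℕ → Carrier
  natK zero    = 0#
  natK (suc n) = 1# + natK n

  CharZero : Set ℓ
  CharZero = ∀ n → ¬ (natK (suc n) ≈ 0#)

-- Angularly decorated planar rooted forests, labels taken in ℕ.
-- A forest  T₁ x₁ T₂ x₂ … xₘ Tₘ₊₁  is represented as the pair
--   ( [(T₁ , x₁) , … , (Tₘ , xₘ)] , Tₘ₊₁ ).
-- A tree is either the one-vertex tree • (leaf) or B⁺(F) for a forest F
-- (node ps l  =  B⁺ (ps , l)).  The angles of B⁺(F) are those of F.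

data Tree : Set where
  leaf : Tree
  node : List (Tree × ℕ) → Tree → Tree

Forest : Set
Forest = List (Tree × ℕ) × Tree

𝟙 : Forest
𝟙 = [] , leaf

gen : ℕ → Forest
gen x = (leaf , x) ∷ [] , leaf

B⁺ : Forest → Forest
B⁺ (ps , l) = [] , node ps l

mutual
  labelsT : Tree → List ℕ
  labelsT leaf       = []
  labelsT (node ps l) = labelsP ps ++ labelsT l

  labelsP : List (Tree × ℕ) → List ℕ
  labelsP []             = []
  labelsP ((t , x) ∷ ps) = labelsT t ++ x ∷ labelsP ps

labels : Forest → List ℕ
labels (ps , l) = labelsP ps ++ labelsT l

mutual
  relabelT : (ℕ → ℕ) → Tree → Tree
  relabelT σ leaf        = leaf
  relabelT σ (node ps l) = node (relabelP σ ps) (relabelT σ l)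

  relabelP : (ℕ → ℕ) → List (Tree × ℕ) → List (Tree × ℕ)
  relabelP σ []             = []
  relabelP σ ((t , x) ∷ ps) = (relabelT σ t , σ x) ∷ relabelP σ ps

relabel : (ℕ → ℕ) → Forest → Forest
relabel σ (ps , l) = relabelP σ ps , relabelT σ l

mutual
  _≟T_ : DecidableEquality Tree
  leaf ≟T leaf = yes refl
  leaf ≟T node _ _ = no λ ()
  node _ _ ≟T leaf = no λ ()
  node ps l ≟T node qs m with ps ≟P qs | l ≟T m
  ... | yes refl | yes refl = yes refl
  ... | no ne    | _        = no λ { refl → ne refl }
  ... | yes _    | no ne    = no λ { refl → ne refl }

  _≟P_ : DecidableEquality (List (Tree × ℕ))
  [] ≟P [] = yes refl
  [] ≟P (_ ∷ _) = no λ ()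
  (_ ∷ _) ≟P [] = no λ ()
  ((t , x) ∷ ps) ≟P ((u , y) ∷ qs) with t ≟T u | x ℕ.≟ y | ps ≟P qs
  ... | yes refl | yes refl | yes refl = yes refl
  ... | no ne    | _        | _        = no λ { refl → ne refl }
  ... | yes _    | no ne    | _        = no λ { refl → ne refl }
  ... | yes _    | yes _    | no ne    = no λ { refl → ne refl }

_≟F_ : DecidableEquality Forest
(ps , l) ≟F (qs , m) = map′ (λ { (refl , refl) → refl }) (λ { refl → refl , refl })
                            (ps ≟P qs ×-dec l ≟T m)

_≟FF_ : DecidableEquality (Forest × Forest)
(a , b) ≟FF (c , d) = map′ (λ { (refl , refl) → refl }) (λ { refl → refl , refl })
                           (a ≟F c ×-dec b ≟F d)

_≟FFF_ : DecidableEquality ((Forest × Forest) × Forest)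
(a , b) ≟FFF (c , d) = map′ (λ { (refl , refl) → refl }) (λ { refl → refl , refl })
                            (a ≟FF c ×-dec b ≟F d)

-- Free K-vector spaces as formal linear combinations, compared
-- coefficientwise.

module Lin {c ℓ} (K : CommutativeRing c ℓ) where
  open CommutativeRing K

  Lin : Set → Set c
  Lin B = List (Carrier × B)

  η : ∀ {B} → B → Lin B
  η b = (1# , b) ∷ []

  scale : ∀ {B} → Carrier → Lin B → Lin B
  scale a = map (λ { (k , b) → (a * k , b) })

  mapL : ∀ {B C} → (B → C) → Lin B → Lin C
  mapL f = map (λ { (k , b) → (k , f b) })

  bind : ∀ {B C} → Lin B → (B → Lin C) → Lin C
  bind v f = concatMap (λ { (k , b) → scale k (f b) }) v

  bind₂ : ∀ {A B C} → Lin A → Lin B → (A → B → Lin C) → Lin C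
  bind₂ u v f = bind u (λ a → bind v (λ b → f a b))

  _⊗L_ : ∀ {A B} → Lin A → Lin B → Lin (A × B)
  u ⊗L v = bind₂ u v (λ a b → η (a , b))

  coeff : ∀ {B} → DecidableEquality B → Lin B → B → Carrier
  coeff _≟_ []             b = 0#
  coeff _≟_ ((k , b') ∷ v) b with b' ≟ b
  ... | yes _ = k + coeff _≟_ v b
  ... | no  _ = coeff _≟_ v b

  Eq : ∀ {B} → DecidableEquality B → Lin B → Lin B → Set ℓ
  Eq _≟_ u v = ∀ b → coeff _≟_ u b ≈ coeff _≟_ v b

module ADF {c ℓ} (K : CommutativeRing c ℓ) (λw : CommutativeRing.Carrier K) where
  open CommutativeRing K
  open Lin K public

  _⋄T_ : Tree → Tree → Lin Tree
  leaf ⋄T t' = η t'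
  node ps l ⋄T leaf = η (node ps l)
  -- A = (ps , l), A' = ([] , l')
  node ps l ⋄T node [] l' =
       mapL (λ s → node [] s) (node ps l ⋄T l')          -- B⁺(B⁺(A) ⋄ A')
    ++ mapL (λ s → node ps s) (l ⋄T node [] l')          -- B⁺(A ⋄ B⁺(A'))
    ++ scale λw (mapL (λ s → node ps s) (l ⋄T l'))       -- λ B⁺(A ⋄ A')
  -- A = (ps , l), A' = ((t , x) ∷ qs , l')
  node ps l ⋄T node ((t , x) ∷ qs) l' =
       mapL (λ s → node ((s , x) ∷ qs) l') (node ps l ⋄T t)
    ++ mapL (λ s → node ps s) (l ⋄T node ((t , x) ∷ qs) l')
    ++ scale λw (mapL (λ s → node (ps ++ (s , x) ∷ qs) l') (l ⋄T t))

  -- product of forests: T₁x₁…xₘ(Tₘ₊₁ ⋄ T'₁)y₁…yₙT'ₙ₊₁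
  _⋄_ : Forest → Forest → Lin Forest
  (ps , l) ⋄ ([] , l')            = mapL (λ s → ps , s) (l ⋄T l')
  (ps , l) ⋄ ((t , x) ∷ qs , l') = mapL (λ s → ps ++ (s , x) ∷ qs , l') (l ⋄T t)

  ε : Forest → Carrier
  ε ([] , leaf) = 1#
  ε _           = 0#

  _≈₁_ : Lin Forest → Lin Forest → Set ℓ
  _≈₁_ = Eq _≟F_
  _≈₂_ : Lin (Forest × Forest) → Lin (Forest × Forest) → Set ℓ
  _≈₂_ = Eq _≟FF_
  _≈₃_ : Lin ((Forest × Forest) × Forest) → Lin ((Forest × Forest) × Forest) → Set ℓ
  _≈₃_ = Eq _≟FFF_

  _⋄₂_ : Lin (Forest × Forest) → Lin (Forest × Forest) → Lin (Forest × Forest)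
  u ⋄₂ v = bind₂ u v (λ { (F₁ , G₁) (F₂ , G₂) → (F₁ ⋄ F₂) ⊗L (G₁ ⋄ G₂) })

  R₂ : Forest × Forest → Lin (Forest × Forest)
  R₂ (F , G) = η (B⁺ F , G) ++ scale (ε F) (η (𝟙 , B⁺ G))

  -- Δ maps ADF[X] into (ADF ⊗ ADF)[X]
  Graded : (Forest → Lin (Forest × Forest)) → Set (c ⊔ ℓ)
  Graded Δ = ∀ F → Unique (labels F) →
    ∃ λ v → (Δ F ≈₂ v) × All (λ { (_ , (G , H)) → (labels G ++ labels H) ↭ labels F }) v

  NaturalΔ : (Forest → Lin (Forest × Forest)) → Set ℓ
  NaturalΔ Δ = ∀ (σ : ℕ ↔ ℕ) F → Unique (labels F) →
    Δ (relabel (Inverse.to σ) F)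
      ≈₂ mapL (λ { (G , H) → relabel (Inverse.to σ) G , relabel (Inverse.to σ) H }) (Δ F)

  record IsΔ (Δ : Forest → Lin (Forest × Forest)) : Set (c ⊔ ℓ) where
    field
      graded    : Graded Δ
      natural   : NaturalΔ Δ
      unit      : Δ 𝟙 ≈₂ η (𝟙 , 𝟙)
      product   : ∀ F G → Unique (labels F ++ labels G) →
                  bind (F ⋄ G) Δ ≈₂ (Δ F ⋄₂ Δ G)
      operator  : ∀ F → Unique (labels F) → Δ (B⁺ F) ≈₂ bind (Δ F) R₂
      generator : ∀ x → Δ (gen x) ≈₂ (η (gen x , 𝟙) ++ η (𝟙 , gen x))

  record IsTwistedCoalgebra (Δ : Forest → Lin (Forest × Forest)) (e : Forest → Carrier)
         : Set (c ⊔ ℓ) where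
    field
      Δ-graded   : Graded Δ
      Δ-natural  : NaturalΔ Δ
      -- ε is a morphism of species ADF → 1_k
      e-graded   : ∀ F → ¬ (labels F ≡ []) → e F ≈ 0#
      e-natural  : ∀ (σ : ℕ ↔ ℕ) F → Unique (labels F) → e (relabel (Inverse.to σ) F) ≈ e F
      coassoc    : ∀ F → Unique (labels F) →
        bind (Δ F) (λ { (G , H) → mapL (λ { (G₁ , G₂) → (G₁ , G₂) , H }) (Δ G) })
          ≈₃ bind (Δ F) (λ { (G , H) → mapL (λ { (H₁ , H₂) → (G , H₁) , H₂ }) (Δ H) })
      counitˡ    : ∀ F → Unique (labels F) →
        bind (Δ F) (λ { (G , H) → scale (e G) (η H) }) ≈₁ η F
      counitʳ    : ∀ F → Unique (labels F) →
        bind (Δ F) (λ { (G , H) → scale (e H) (η G) }) ≈₁ η F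

{-# OPTIONS --safe #-}

-- Counitality and coassociativity are proved for each forest with distinct labels, by induction
-- along the generation of ADF from • and the forests •x• under B⁺ and ⋄: a forest T₁x₁T₂⋯ is
-- T₁ ⋄ (•x₁• ⋄ T₂x₂⋯), and a tree other than • is B⁺ of a forest.  Since Δ is a morphism of Rota–Baxter species, (ε ⊗ id)Δ and (id ⊗ ε)Δ
-- commute with B⁺ and are multiplicative (because ε is), while (Δ ⊗ id)Δ and (id ⊗ Δ)Δ both
-- intertwine B⁺ with  R⁽³⁾(F ⊗ G ⊗ H) = B⁺F ⊗ G ⊗ H + ε(F) • ⊗ B⁺G ⊗ H + ε(F)ε(G) • ⊗ • ⊗ B⁺H
-- (for (Δ ⊗ id)Δ this needs ε = (ε ⊗ ε)Δ, so counitality comes first) and are multiplicative for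
-- the componentwise product.
--
-- Vectors are handled through linear forms: u and v have equal coefficients iff ∑ u f ≈ ∑ v f for
-- all f, and for a map M on basis vectors, Mᵀ h is the form h ∘ M.  Because Δ is graded, the labels
-- of the tensor factors occurring in Δ F split those of F, which keeps the distinct-label
-- hypotheses of the morphism axioms available inside the induction.

module Submission where

open import Defs
open import Algebra.Bundles using (CommutativeRing)
open import Data.Product using (_×_; _,_; proj₁; proj₂; uncurry)
open import Data.Nat using (ℕ)
open import Data.List using (List; []; _∷_; _++_; map; deduplicate)
open import Data.List.Relation.Unary.All as All using (All; []; _∷_)
import Data.List.Relation.Unary.All.Properties as Allₚ
open import Data.List.Relation.Unary.Any using (here; there)
open import Data.List.Membership.Propositional using (_∈_)
open import Data.List.Membership.Propositional.Properties using (∈-++⁺ˡ; ∈-++⁺ʳ; ∈-map⁺; ∈-deduplicate⁺)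
open import Data.List.Relation.Unary.Unique.Propositional using (Unique)
open import Data.List.Relation.Unary.Unique.DecPropositional.Properties using (deduplicate-!)
import Data.List.Relation.Unary.AllPairs as AllPairs
open import Data.List.Properties using (++-assoc)
open import Data.List.Relation.Binary.Permutation.Propositional using (_↭_; ↭-sym; ↭⇒↭ₛ)
import Data.List.Relation.Binary.Permutation.Propositional.Properties as ↭
import Data.List.Relation.Binary.Permutation.Setoid.Properties as PermutationSetoid
open import Relation.Binary.PropositionalEquality as ≡ using (_≡_)
open import Relation.Binary.Definitions using (DecidableEquality)
open import Relation.Nullary using (¬_; yes; no)
open import Data.Empty using (⊥-elim)
open import Level using (_⊔_)
open import Function.Bundles using (Inverse)

module LinearForms {c ℓ} (K : CommutativeRing c ℓ) where
  open CommutativeRing K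
  open Lin K
  open import Relation.Binary.Reasoning.Setoid setoid
  open import Algebra.Properties.CommutativeSemigroup +-commutativeSemigroup using (interchange)
  open import Algebra.Properties.CommutativeSemigroup *-commutativeSemigroup using (x∙yz≈y∙xz)

  ∑ : ∀ {B : Set} → Lin B → (B → Carrier) → Carrier
  ∑ []            f = 0#
  ∑ ((k , b) ∷ u) f = k * f b + ∑ u f

  ∑₂ : ∀ {B C : Set} → Lin (B × C) → (B → C → Carrier) → Carrier
  ∑₂ u f = ∑ u (uncurry f)

  infix 5 ∑ ∑₂
  syntax ∑  u (λ b → e)   = ∑[ b ∈ u ] e
  syntax ∑₂ u (λ b c → e) = ∑[ b ⊗ c ∈ u ] e

  infix 4 _≃_
  _≃_ : ∀ {B : Set} → Lin B → Lin B → Set (c ⊔ ℓ)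
  u ≃ v = ∀ f → ∑ u f ≈ ∑ v f

  module _ {B : Set} where

    ∑-cong : ∀ (u : Lin B) {f g} → (∀ b → f b ≈ g b) → ∑ u f ≈ ∑ u g
    ∑-cong []            f≈g = refl
    ∑-cong ((k , b) ∷ u) f≈g = +-cong (*-congˡ (f≈g b)) (∑-cong u f≈g)

    ∑-congᴬ : ∀ {p} {P : Carrier × B → Set p} {u : Lin B} {f g} → All P u →
              (∀ {k b} → P (k , b) → f b ≈ g b) → ∑ u f ≈ ∑ u g
    ∑-congᴬ []         f≈g = refl
    ∑-congᴬ (pkb ∷ pu) f≈g = +-cong (*-congˡ (f≈g pkb)) (∑-congᴬ pu f≈g)

    ∑-0 : ∀ (u : Lin B) {f} → (∀ b → f b ≈ 0#) → ∑ u f ≈ 0#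
    ∑-0 []            f≈0 = refl
    ∑-0 ((k , b) ∷ u) f≈0 = begin
      k * _ + ∑ u _  ≈⟨ +-cong (*-congˡ (f≈0 b)) (∑-0 u f≈0) ⟩
      k * 0# + 0#    ≈⟨ +-identityʳ _ ⟩
      k * 0#         ≈⟨ zeroʳ k ⟩
      0#             ∎

    ∑-+ : ∀ (u : Lin B) f g → ∑[ b ∈ u ] (f b + g b) ≈ ∑ u f + ∑ u g
    ∑-+ []            f g = sym (+-identityʳ 0#)
    ∑-+ ((k , b) ∷ u) f g = begin
      k * (f b + g b) + (∑[ b ∈ u ] f b + g b) ≈⟨ +-cong (distribˡ k (f b) (g b)) (∑-+ u f g) ⟩
      (k * f b + k * g b) + (∑ u f + ∑ u g)    ≈⟨ interchange _ _ _ _ ⟩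
      (k * f b + ∑ u f) + (k * g b + ∑ u g)    ∎

    ∑-*ˡ : ∀ (u : Lin B) a f → ∑[ b ∈ u ] (a * f b) ≈ a * ∑ u f
    ∑-*ˡ []            a f = sym (zeroʳ a)
    ∑-*ˡ ((k , b) ∷ u) a f = begin
      k * (a * f b) + (∑[ b ∈ u ] a * f b) ≈⟨ +-cong (x∙yz≈y∙xz k a (f b)) (∑-*ˡ u a f) ⟩
      a * (k * f b) + a * ∑ u f            ≈⟨ distribˡ a _ _ ⟨
      a * (k * f b + ∑ u f)                ∎

    ∑-*ʳ : ∀ (u : Lin B) a f → ∑[ b ∈ u ] (f b * a) ≈ ∑ u f * a
    ∑-*ʳ u a f = begin
      ∑[ b ∈ u ] (f b * a) ≈⟨ ∑-cong u (λ b → *-comm (f b) a) ⟩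
      ∑[ b ∈ u ] (a * f b) ≈⟨ ∑-*ˡ u a f ⟩
      a * ∑ u f            ≈⟨ *-comm a _ ⟩
      ∑ u f * a            ∎

    ∑-++ : ∀ (u v : Lin B) f → ∑ (u ++ v) f ≈ ∑ u f + ∑ v f
    ∑-++ []            v f = sym (+-identityˡ _)
    ∑-++ ((k , b) ∷ u) v f = trans (+-congˡ (∑-++ u v f)) (sym (+-assoc _ _ _))

    ∑-scale : ∀ a (u : Lin B) f → ∑ (scale a u) f ≈ a * ∑ u f
    ∑-scale a []            f = sym (zeroʳ a)
    ∑-scale a ((k , b) ∷ u) f = begin
      a * k * f b + ∑ (scale a u) f ≈⟨ +-cong (*-assoc a k (f b)) (∑-scale a u f) ⟩
      a * (k * f b) + a * ∑ u f     ≈⟨ distribˡ a _ _ ⟨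
      a * (k * f b + ∑ u f)         ∎

    ∑-η : ∀ (b : B) f → ∑ (η b) f ≈ f b
    ∑-η b f = trans (+-identityʳ _) (*-identityˡ _)

    ∑-≡η : ∀ {u : Lin B} {b} → u ≡ η b → ∀ f → ∑ u f ≈ f b
    ∑-≡η ≡.refl f = ∑-η _ f

  ∑-mapL : ∀ {B C : Set} (g : B → C) (u : Lin B) f → ∑ (mapL g u) f ≈ ∑[ b ∈ u ] f (g b)
  ∑-mapL g []            f = refl
  ∑-mapL g ((k , b) ∷ u) f = +-congˡ (∑-mapL g u f)

  ∑-bind : ∀ {B C : Set} (u : Lin B) (g : B → Lin C) f → ∑ (bind u g) f ≈ ∑[ b ∈ u ] ∑ (g b) f
  ∑-bind []            g f = refl
  ∑-bind ((k , b) ∷ u) g f = trans (∑-++ (scale k (g b)) (bind u g) f) (+-cong (∑-scale k (g b) f) (∑-bind u g f))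

  ∑-comm : ∀ {B C : Set} (u : Lin B) (v : Lin C) (f : B → C → Carrier) → ∑[ b ∈ u ] ∑[ c ∈ v ] f b c ≈ ∑[ c ∈ v ] ∑[ b ∈ u ] f b c
  ∑-comm []            v f = sym (∑-0 v (λ _ → refl))
  ∑-comm ((k , b) ∷ u) v f = begin
    k * (∑[ c ∈ v ] f b c) + (∑[ b ∈ u ] ∑[ c ∈ v ] f b c)    ≈⟨ +-cong (sym (∑-*ˡ v k (f b))) (∑-comm u v f) ⟩
    (∑[ c ∈ v ] k * f b c) + (∑[ c ∈ v ] ∑[ b ∈ u ] f b c)  ≈⟨ ∑-+ v _ _ ⟨
    ∑[ c ∈ v ] k * f b c + (∑[ b ∈ u ] f b c)                 ∎

  ∑-⊗ : ∀ {B C : Set} (u : Lin B) (v : Lin C) (f : B × C → Carrier) → ∑ (u ⊗L v) f ≈ ∑[ b ∈ u ] ∑[ c ∈ v ] f (b , c)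
  ∑-⊗ u v f = begin
    ∑ (u ⊗L v) f                                 ≈⟨ ∑-bind u (λ b → bind v (λ c → η (b , c))) f ⟩
    ∑[ b ∈ u ] ∑ (bind v (λ c → η (b , c))) f    ≈⟨ ∑-cong u (λ b → ∑-bind v (λ c → η (b , c)) f) ⟩
    ∑[ b ∈ u ] ∑[ c ∈ v ] ∑ (η (b , c)) f        ≈⟨ ∑-cong u (λ b → ∑-cong v (λ c → ∑-η (b , c) f)) ⟩
    ∑[ b ∈ u ] ∑[ c ∈ v ] f (b , c)              ∎

  module _ {B : Set} (_≟_ : DecidableEquality B) where
    private
      δ : B → B → Carrier
      δ b = coeff _≟_ (η b)

      δ-≢ : ∀ {b b'} → ¬ b ≡ b' → δ b b' ≈ 0#
      δ-≢ {b} {b'} b≢b' with b ≟ b'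
      ... | yes b≡b' = ⊥-elim (b≢b' b≡b')
      ... | no  _    = refl

      δ-≡ : ∀ b → δ b b ≈ 1#
      δ-≡ b with b ≟ b
      ... | yes _    = +-identityʳ 1#
      ... | no  b≢b = ⊥-elim (b≢b ≡.refl)

      coeff-∑ : ∀ (u : Lin B) b → coeff _≟_ u b ≈ ∑[ b' ∈ u ] δ b' b
      coeff-∑ []             b = refl
      coeff-∑ ((k , b') ∷ u) b with b' ≟ b
      ... | yes _ = +-cong (sym (trans (*-congˡ (+-identityʳ 1#)) (*-identityʳ k))) (coeff-∑ u b)
      ... | no  _ = trans (coeff-∑ u b) (sym (trans (+-congʳ (zeroʳ k)) (+-identityˡ _)))

      uniform : List B → Lin B
      uniform = map (1# ,_)

      ∑-δ-absent : ∀ {b} S (g : B → Carrier) → All (λ b' → ¬ b ≡ b') S → ∑[ b' ∈ uniform S ] δ b b' * g b' ≈ 0#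
      ∑-δ-absent []      g []            = refl
      ∑-δ-absent (s ∷ S) g (b≢s ∷ b∉S) = begin
        1# * (δ _ s * g s) + (∑[ b' ∈ uniform S ] δ _ b' * g b') ≈⟨ +-cong (*-identityˡ _) (∑-δ-absent S g b∉S) ⟩
        δ _ s * g s + 0#                                        ≈⟨ +-identityʳ _ ⟩
        δ _ s * g s                                             ≈⟨ *-congʳ (δ-≢ b≢s) ⟩
        0# * g s                                                ≈⟨ zeroˡ _ ⟩
        0#                                                      ∎

      ∑-δ-present : ∀ {b} S (g : B → Carrier) → Unique S → b ∈ S → ∑[ b' ∈ uniform S ] δ b b' * g b' ≈ g b
      ∑-δ-present (s ∷ S) g (s∉S AllPairs.∷ _) (here ≡.refl) = begin
        1# * (δ s s * g s) + (∑[ b' ∈ uniform S ] δ s b' * g b') ≈⟨ +-cong (*-identityˡ _) (∑-δ-absent S g s∉S) ⟩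
        δ s s * g s + 0#                                        ≈⟨ +-identityʳ _ ⟩
        δ s s * g s                                             ≈⟨ *-congʳ (δ-≡ s) ⟩
        1# * g s                                                ≈⟨ *-identityˡ _ ⟩
        g s                                                     ∎
      ∑-δ-present {b} (s ∷ S) g (s∉S AllPairs.∷ uS) (there b∈S) = begin
        1# * (δ b s * g s) + (∑[ b' ∈ uniform S ] δ b b' * g b') ≈⟨ +-cong (*-identityˡ _) (∑-δ-present S g uS b∈S) ⟩
        δ b s * g s + g b                                       ≈⟨ +-congʳ (*-congʳ (δ-≢ b≢s)) ⟩
        0# * g s + g b                                          ≈⟨ +-congʳ (zeroˡ _) ⟩
        0# + g b                                                ≈⟨ +-identityˡ _ ⟩
        g b                                                     ∎
        where b≢s = λ b≡s → All.lookup s∉S b∈S (≡.sym b≡s)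

      ∑-by-coeff : ∀ {S} (u : Lin B) (g : B → Carrier) → Unique S → All (λ kb → proj₂ kb ∈ S) u →
                   ∑ u g ≈ ∑[ b ∈ uniform S ] coeff _≟_ u b * g b
      ∑-by-coeff {S} u g uS u⊆S = begin
        ∑ u g                                                 ≈⟨ ∑-congᴬ u⊆S (λ b∈S → ∑-δ-present S g uS b∈S) ⟨
        ∑[ b' ∈ u ] ∑[ b ∈ uniform S ] δ b' b * g b           ≈⟨ ∑-comm u (uniform S) (λ b' b → δ b' b * g b) ⟩
        ∑[ b ∈ uniform S ] ∑[ b' ∈ u ] δ b' b * g b           ≈⟨ ∑-cong (uniform S) (λ b → ∑-*ʳ u (g b) (λ b' → δ b' b)) ⟩
        ∑[ b ∈ uniform S ] (∑[ b' ∈ u ] δ b' b) * g b         ≈⟨ ∑-cong (uniform S) (λ b → *-congʳ (coeff-∑ u b)) ⟨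
        ∑[ b ∈ uniform S ] coeff _≟_ u b * g b                ∎

    Eq⇒≃ : ∀ {u v : Lin B} → Eq _≟_ u v → u ≃ v
    Eq⇒≃ {u} {v} u≈v g = begin
      ∑ u g                                  ≈⟨ ∑-by-coeff u g uS (support⊆S (∈-++⁺ˡ {ys = map proj₂ v})) ⟩
      ∑[ b ∈ uniform S ] coeff _≟_ u b * g b ≈⟨ ∑-cong (uniform S) (λ b → *-congʳ (u≈v b)) ⟩
      ∑[ b ∈ uniform S ] coeff _≟_ v b * g b ≈⟨ ∑-by-coeff v g uS (support⊆S (∈-++⁺ʳ (map proj₂ u))) ⟨
      ∑ v g                                  ∎
      where
      S  = deduplicate _≟_ (map proj₂ u ++ map proj₂ v)
      uS = deduplicate-! _≟_ (map proj₂ u ++ map proj₂ v)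
      support⊆S : ∀ {w : Lin B} → (∀ {b} → b ∈ map proj₂ w → b ∈ map proj₂ u ++ map proj₂ v) →
                  All (λ kb → proj₂ kb ∈ S) w
      support⊆S w⊆ = All.tabulate (λ kb∈w → ∈-deduplicate⁺ _≟_ (w⊆ (∈-map⁺ proj₂ kb∈w)))

    ≃⇒Eq : ∀ {u v : Lin B} → u ≃ v → Eq _≟_ u v
    ≃⇒Eq {u} {v} u≃v b = trans (coeff-∑ u b) (trans (u≃v (λ b' → δ b' b)) (sym (coeff-∑ v b)))

module _ {A : Set} where

  Unique-++⁻ˡ : ∀ (xs : List A) {ys} → Unique (xs ++ ys) → Unique xs
  Unique-++⁻ˡ []       _                    = AllPairs.[]
  Unique-++⁻ˡ (x ∷ xs) (x∉xs++ys AllPairs.∷ u) = Allₚ.++⁻ˡ xs x∉xs++ys AllPairs.∷ Unique-++⁻ˡ xs u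

  Unique-++⁻ʳ : ∀ (xs : List A) {ys} → Unique (xs ++ ys) → Unique ys
  Unique-++⁻ʳ []       u               = u
  Unique-++⁻ʳ (x ∷ xs) (_ AllPairs.∷ u) = Unique-++⁻ʳ xs u

  Unique-resp-↭ : ∀ {xs ys : List A} → xs ↭ ys → Unique xs → Unique ys
  Unique-resp-↭ xs↭ys = PermutationSetoid.Unique-resp-↭ (≡.setoid A) (↭⇒↭ₛ xs↭ys)

  Unique-interchange : ∀ (ws xs ys : List A) {zs} →
                       Unique ((ws ++ xs) ++ (ys ++ zs)) → Unique ((ws ++ ys) ++ (xs ++ zs))
  Unique-interchange ws xs ys {zs} u =
    ≡.subst Unique (≡.sym (++-assoc ws ys (xs ++ zs)))
      (Unique-resp-↭ (↭.++⁺ˡ ws (↭.shifts xs ys))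
        (≡.subst Unique (++-assoc ws xs (ys ++ zs)) u))

module ForestAlgebra {c ℓ} (K : CommutativeRing c ℓ) (λw : CommutativeRing.Carrier K) where
  open CommutativeRing K
  open ADF K λw
  open LinearForms K
  open import Relation.Binary.Reasoning.Setoid setoid

  tree-⋄-•x : ∀ t x qs l → ([] , t) ⋄ ((leaf , x) ∷ qs , l) ≡ η ((t , x) ∷ qs , l)
  tree-⋄-•x leaf       x qs l = ≡.refl
  tree-⋄-•x (node _ _) x qs l = ≡.refl

  gen-⋄ : ∀ x qs l → gen x ⋄ (qs , l) ≡ η ((leaf , x) ∷ qs , l)
  gen-⋄ x []      l = ≡.refl
  gen-⋄ x (_ ∷ _) l = ≡.refl

  forest-induction : ∀ {p} (P : Forest → Set p) → P 𝟙 → (∀ x → P (gen x)) →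
    (∀ G → Unique (labels G) → P G → P (B⁺ G)) →
    (∀ A B F → Unique (labels A ++ labels B) → A ⋄ B ≡ η F → P A → P B → P F) →
    ∀ F → Unique (labels F) → P F
  forest-induction P P𝟙 Pgen PB⁺ P⋄ (ps , l) = forest ps l
    where
    tree   : ∀ t → Unique (labelsT t) → P ([] , t)
    forest : ∀ ps l → Unique (labelsP ps ++ labelsT l) → P (ps , l)

    tree leaf        _ = P𝟙
    tree (node ps l) u = PB⁺ (ps , l) u (forest ps l u)

    forest []             l u = tree l u
    forest ((t , x) ∷ qs) l u =
      P⋄ ([] , t) _ _ u′ (tree-⋄-•x t x qs l) (tree t (Unique-++⁻ˡ (labelsT t) u′))
         (P⋄ (gen x) (qs , l) _ u″ (gen-⋄ x qs l) (Pgen x) (forest qs l (Unique-++⁻ʳ (x ∷ []) u″)))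
      where
      u′ = ≡.subst Unique (++-assoc (labelsT t) (x ∷ labelsP qs) (labelsT l)) u
      u″ = Unique-++⁻ʳ (labelsT t) u′

  ε-vanishes : ∀ F → ¬ labels F ≡ [] → ε F ≈ 0#
  ε-vanishes ([] , leaf)     labels≢[] = ⊥-elim (labels≢[] ≡.refl)
  ε-vanishes ([] , node _ _) _         = refl
  ε-vanishes (_ ∷ _ , _)     _         = refl

  ε-relabel : ∀ σ F → ε (relabel σ F) ≈ ε F
  ε-relabel σ ([] , leaf)     = refl
  ε-relabel σ ([] , node _ _) = refl
  ε-relabel σ (_ ∷ _ , _)     = refl

  private
    εT : Tree → Carrier
    εT t = ε ([] , t)

    ∑-εT-nodes : ∀ {f : Tree → List (Tree × ℕ)} {g : Tree → Tree} u →
                 ∑ (mapL (λ s → node (f s) (g s)) u) εT ≈ 0#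
    ∑-εT-nodes u = trans (∑-mapL _ u εT) (∑-0 u (λ _ → refl))

    ∑-εT-grafts : ∀ {a₁ a₂ a₃ : Tree → List (Tree × ℕ)} {b₁ b₂ b₃ : Tree → Tree} u₁ u₂ u₃ →
      ∑ (mapL (λ s → node (a₁ s) (b₁ s)) u₁ ++ mapL (λ s → node (a₂ s) (b₂ s)) u₂
         ++ scale λw (mapL (λ s → node (a₃ s) (b₃ s)) u₃)) εT ≈ 0#
    ∑-εT-grafts {a₁} {a₂} {a₃} {b₁} {b₂} {b₃} u₁ u₂ u₃ = begin
      ∑ (w₁ ++ w₂ ++ scale λw w₃) εT                 ≈⟨ ∑-++ w₁ _ εT ⟩
      ∑ w₁ εT + ∑ (w₂ ++ scale λw w₃) εT            ≈⟨ +-congˡ (∑-++ w₂ _ εT) ⟩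
      ∑ w₁ εT + (∑ w₂ εT + ∑ (scale λw w₃) εT)      ≈⟨ +-congˡ (+-congˡ (∑-scale λw w₃ εT)) ⟩
      ∑ w₁ εT + (∑ w₂ εT + λw * ∑ w₃ εT)            ≈⟨ +-cong (∑-εT-nodes u₁) (+-cong (∑-εT-nodes u₂) (*-congˡ (∑-εT-nodes u₃))) ⟩
      0# + (0# + λw * 0#)                           ≈⟨ trans (+-identityˡ _) (trans (+-identityˡ _) (zeroʳ λw)) ⟩
      0#                                            ∎
      where
      w₁ = mapL (λ s → node (a₁ s) (b₁ s)) u₁
      w₂ = mapL (λ s → node (a₂ s) (b₂ s)) u₂
      w₃ = mapL (λ s → node (a₃ s) (b₃ s)) u₃

    εT-⋄T : ∀ t t' → ∑ (t ⋄T t') εT ≈ εT t * εT t'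
    εT-⋄T leaf        t'   = trans (∑-η t' εT) (sym (*-identityˡ _))
    εT-⋄T (node ps l) leaf = trans (∑-η (node ps l) εT) (sym (zeroˡ _))
    εT-⋄T (node ps l) (node [] l') =
      trans (∑-εT-grafts (node ps l ⋄T l') (l ⋄T node [] l') (l ⋄T l')) (sym (zeroˡ _))
    εT-⋄T (node ps l) (node ((t , x) ∷ qs) l') =
      trans (∑-εT-grafts (node ps l ⋄T t) (l ⋄T node ((t , x) ∷ qs) l') (l ⋄T t)) (sym (zeroˡ _))

  ε-⋄ : ∀ F G → ∑ (F ⋄ G) ε ≈ ε F * ε G
  ε-⋄ ([] , l)    ([] , l') = trans (∑-mapL _ (l ⋄T l') ε) (εT-⋄T l l')
  ε-⋄ (_ ∷ _ , l) ([] , l') =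
    trans (∑-mapL _ (l ⋄T l') ε) (trans (∑-0 (l ⋄T l') (λ _ → refl)) (sym (zeroˡ _)))
  ε-⋄ ([] , l)    ((t , _) ∷ _ , _) =
    trans (∑-mapL _ (l ⋄T t) ε) (trans (∑-0 (l ⋄T t) (λ _ → refl)) (sym (zeroʳ _)))
  ε-⋄ (_ ∷ _ , l) ((t , _) ∷ _ , _) =
    trans (∑-mapL _ (l ⋄T t) ε) (trans (∑-0 (l ⋄T t) (λ _ → refl)) (sym (zeroʳ _)))

  R₂ᵀ : (Forest × Forest → Carrier) → Forest × Forest → Carrier
  R₂ᵀ φ (G , H) = φ (B⁺ G , H) + ε G * φ (𝟙 , B⁺ H)

  ∑-R₂ : ∀ φ p → ∑ (R₂ p) φ ≈ R₂ᵀ φ p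
  ∑-R₂ φ (G , H) = begin
    ∑ (η (B⁺ G , H) ++ scale (ε G) (η (𝟙 , B⁺ H))) φ        ≈⟨ ∑-++ (η (B⁺ G , H)) (scale (ε G) (η (𝟙 , B⁺ H))) φ ⟩
    ∑ (η (B⁺ G , H)) φ + ∑ (scale (ε G) (η (𝟙 , B⁺ H))) φ   ≈⟨ +-cong (∑-η (B⁺ G , H) φ) (∑-scale (ε G) (η (𝟙 , B⁺ H)) φ) ⟩
    φ (B⁺ G , H) + ε G * ∑ (η (𝟙 , B⁺ H)) φ                 ≈⟨ +-congˡ (*-congˡ (∑-η (𝟙 , B⁺ H) φ)) ⟩
    φ (B⁺ G , H) + ε G * φ (𝟙 , B⁺ H)                       ∎

  ⋄₂ᵀ : (Forest × Forest → Carrier) → Forest × Forest → Forest × Forest → Carrier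
  ⋄₂ᵀ φ (F₁ , G₁) (F₂ , G₂) = ∑[ X ∈ F₁ ⋄ F₂ ] ∑[ Y ∈ G₁ ⋄ G₂ ] φ (X , Y)

  ∑-⋄₂ : ∀ u v φ → ∑ (u ⋄₂ v) φ ≈ ∑[ p ∈ u ] ∑[ q ∈ v ] ⋄₂ᵀ φ p q
  ∑-⋄₂ u v φ = trans (∑-bind u _ φ) (∑-cong u λ p → trans (∑-bind v _ φ) (∑-cong v λ q →
                 ∑-⊗ (proj₁ p ⋄ proj₁ q) (proj₂ p ⋄ proj₂ q) φ))

  ⋄₂ᵀ-ε⊗id : ∀ g p q → ⋄₂ᵀ (uncurry λ X Y → ε X * g Y) p q ≈ ε (proj₁ p) * (ε (proj₁ q) * ∑ (proj₂ p ⋄ proj₂ q) g)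
  ⋄₂ᵀ-ε⊗id g (F₁ , G₁) (F₂ , G₂) = begin
    ∑[ X ∈ F₁ ⋄ F₂ ] ∑[ Y ∈ G₁ ⋄ G₂ ] ε X * g Y   ≈⟨ ∑-cong (F₁ ⋄ F₂) (λ X → ∑-*ˡ (G₁ ⋄ G₂) (ε X) g) ⟩
    ∑[ X ∈ F₁ ⋄ F₂ ] ε X * ∑ (G₁ ⋄ G₂) g         ≈⟨ ∑-*ʳ (F₁ ⋄ F₂) (∑ (G₁ ⋄ G₂) g) ε ⟩
    ∑ (F₁ ⋄ F₂) ε * ∑ (G₁ ⋄ G₂) g                ≈⟨ *-congʳ (ε-⋄ F₁ F₂) ⟩
    (ε F₁ * ε F₂) * ∑ (G₁ ⋄ G₂) g                ≈⟨ *-assoc _ _ _ ⟩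
    ε F₁ * (ε F₂ * ∑ (G₁ ⋄ G₂) g)                ∎

  ⋄₂ᵀ-id⊗ε : ∀ g p q → ⋄₂ᵀ (uncurry λ X Y → ε Y * g X) p q ≈ ε (proj₂ p) * (ε (proj₂ q) * ∑ (proj₁ p ⋄ proj₁ q) g)
  ⋄₂ᵀ-id⊗ε g (F₁ , G₁) (F₂ , G₂) = begin
    ∑[ X ∈ F₁ ⋄ F₂ ] ∑[ Y ∈ G₁ ⋄ G₂ ] ε Y * g X   ≈⟨ ∑-cong (F₁ ⋄ F₂) (λ X → ∑-*ʳ (G₁ ⋄ G₂) (g X) ε) ⟩
    ∑[ X ∈ F₁ ⋄ F₂ ] ∑ (G₁ ⋄ G₂) ε * g X         ≈⟨ ∑-cong (F₁ ⋄ F₂) (λ X → *-congʳ (ε-⋄ G₁ G₂)) ⟩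
    ∑[ X ∈ F₁ ⋄ F₂ ] (ε G₁ * ε G₂) * g X         ≈⟨ ∑-*ˡ (F₁ ⋄ F₂) (ε G₁ * ε G₂) g ⟩
    (ε G₁ * ε G₂) * ∑ (F₁ ⋄ F₂) g                ≈⟨ *-assoc _ _ _ ⟩
    ε G₁ * (ε G₂ * ∑ (F₁ ⋄ F₂) g)                ∎

  Forest³ : Set
  Forest³ = (Forest × Forest) × Forest

  R₃ᵀ : (Forest³ → Carrier) → Forest³ → Carrier
  R₃ᵀ h ((F , G) , H) = h ((B⁺ F , G) , H) + (ε F * h ((𝟙 , B⁺ G) , H) + (ε F * ε G) * h ((𝟙 , 𝟙) , B⁺ H))

  ⋄₃ᵀ : (Forest³ → Carrier) → Forest³ → Forest³ → Carrier
  ⋄₃ᵀ h ((F₁ , G₁) , H₁) ((F₂ , G₂) , H₂) =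
    ∑[ X ∈ F₁ ⋄ F₂ ] ∑[ Y ∈ G₁ ⋄ G₂ ] ∑[ Z ∈ H₁ ⋄ H₂ ] h ((X , Y) , Z)

module Comultiplication {c ℓ} (K : CommutativeRing c ℓ) (λw : CommutativeRing.Carrier K)
       (Δ : Forest → Lin.Lin K (Forest × Forest)) (isΔ : ADF.IsΔ K λw Δ) where
  open CommutativeRing K
  open ADF K λw
  open LinearForms K
  open ForestAlgebra K λw
  open IsΔ isΔ
  open import Relation.Binary.Reasoning.Setoid setoid

  private
    unit≃ : Δ 𝟙 ≃ η (𝟙 , 𝟙)
    unit≃ = Eq⇒≃ _≟FF_ {Δ 𝟙} {η (𝟙 , 𝟙)} unit

    generator≃ : ∀ x → Δ (gen x) ≃ η (gen x , 𝟙) ++ η (𝟙 , gen x)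
    generator≃ x = Eq⇒≃ _≟FF_ {Δ (gen x)} {η (gen x , 𝟙) ++ η (𝟙 , gen x)} (generator x)

    operator≃ : ∀ G → Unique (labels G) → Δ (B⁺ G) ≃ bind (Δ G) R₂
    operator≃ G uG = Eq⇒≃ _≟FF_ {Δ (B⁺ G)} {bind (Δ G) R₂} (operator G uG)

    product≃ : ∀ A B → Unique (labels A ++ labels B) → bind (A ⋄ B) Δ ≃ Δ A ⋄₂ Δ B
    product≃ A B uAB = Eq⇒≃ _≟FF_ {bind (A ⋄ B) Δ} {Δ A ⋄₂ Δ B} (product A B uAB)

  Δ-𝟙 : ∀ φ → ∑ (Δ 𝟙) φ ≈ φ (𝟙 , 𝟙)
  Δ-𝟙 φ = trans (unit≃ φ) (∑-η (𝟙 , 𝟙) φ)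

  Δ-gen : ∀ x φ → ∑ (Δ (gen x)) φ ≈ φ (gen x , 𝟙) + φ (𝟙 , gen x)
  Δ-gen x φ = begin
    ∑ (Δ (gen x)) φ                                ≈⟨ generator≃ x φ ⟩
    ∑ (η (gen x , 𝟙) ++ η (𝟙 , gen x)) φ           ≈⟨ ∑-++ (η (gen x , 𝟙)) (η (𝟙 , gen x)) φ ⟩
    ∑ (η (gen x , 𝟙)) φ + ∑ (η (𝟙 , gen x)) φ      ≈⟨ +-cong (∑-η (gen x , 𝟙) φ) (∑-η (𝟙 , gen x) φ) ⟩
    φ (gen x , 𝟙) + φ (𝟙 , gen x)                  ∎

  Δ-B⁺ : ∀ G → Unique (labels G) → ∀ φ → ∑ (Δ (B⁺ G)) φ ≈ ∑ (Δ G) (R₂ᵀ φ)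
  Δ-B⁺ G uG φ = begin
    ∑ (Δ (B⁺ G)) φ           ≈⟨ operator≃ G uG φ ⟩
    ∑ (bind (Δ G) R₂) φ      ≈⟨ ∑-bind (Δ G) R₂ φ ⟩
    ∑[ p ∈ Δ G ] ∑ (R₂ p) φ  ≈⟨ ∑-cong (Δ G) (∑-R₂ φ) ⟩
    ∑ (Δ G) (R₂ᵀ φ)          ∎

  Δ-⋄ : ∀ A B → Unique (labels A ++ labels B) → ∀ φ →
        ∑[ X ∈ A ⋄ B ] ∑ (Δ X) φ ≈ ∑[ p ∈ Δ A ] ∑[ q ∈ Δ B ] ⋄₂ᵀ φ p q
  Δ-⋄ A B uAB φ = begin
    ∑[ X ∈ A ⋄ B ] ∑ (Δ X) φ             ≈⟨ ∑-bind (A ⋄ B) Δ φ ⟨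
    ∑ (bind (A ⋄ B) Δ) φ                 ≈⟨ product≃ A B uAB φ ⟩
    ∑ (Δ A ⋄₂ Δ B) φ                     ≈⟨ ∑-⋄₂ (Δ A) (Δ B) φ ⟩
    ∑[ p ∈ Δ A ] ∑[ q ∈ Δ B ] ⋄₂ᵀ φ p q  ∎

  Δ-factor : ∀ A B F → Unique (labels A ++ labels B) → A ⋄ B ≡ η F → ∀ φ →
             ∑ (Δ F) φ ≈ ∑[ p ∈ Δ A ] ∑[ q ∈ Δ B ] ⋄₂ᵀ φ p q
  Δ-factor A B F uAB A⋄B≡F φ = begin
    ∑ (Δ F) φ                            ≈⟨ ∑-≡η A⋄B≡F (λ X → ∑ (Δ X) φ) ⟨
    ∑[ X ∈ A ⋄ B ] ∑ (Δ X) φ             ≈⟨ Δ-⋄ A B uAB φ ⟩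
    ∑[ p ∈ Δ A ] ∑[ q ∈ Δ B ] ⋄₂ᵀ φ p q  ∎

  Δ-cong : ∀ F → Unique (labels F) → ∀ {φ ψ} →
           (∀ {G H} → (labels G ++ labels H) ↭ labels F → φ (G , H) ≈ ψ (G , H)) →
           ∑ (Δ F) φ ≈ ∑ (Δ F) ψ
  Δ-cong F uF {φ} {ψ} φ≈ψ with graded F uF
  ... | v , Δ≈v , v-labels = begin
    ∑ (Δ F) φ  ≈⟨ Eq⇒≃ _≟FF_ {Δ F} {v} Δ≈v φ ⟩
    ∑ v φ      ≈⟨ ∑-congᴬ v-labels φ≈ψ ⟩
    ∑ v ψ      ≈⟨ Eq⇒≃ _≟FF_ {Δ F} {v} Δ≈v ψ ⟨
    ∑ (Δ F) ψ  ∎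

  Δ⊗Δ-cong : ∀ A B → Unique (labels A ++ labels B) → ∀ {φ ψ : Forest × Forest → Forest × Forest → Carrier} →
             (∀ {A₁ A₂ B₁ B₂} → Unique (labels A₁ ++ labels B₁) → Unique (labels A₂ ++ labels B₂) →
                φ (A₁ , A₂) (B₁ , B₂) ≈ ψ (A₁ , A₂) (B₁ , B₂)) →
             ∑[ p ∈ Δ A ] ∑[ q ∈ Δ B ] φ p q ≈ ∑[ p ∈ Δ A ] ∑[ q ∈ Δ B ] ψ p q
  Δ⊗Δ-cong A B uAB φ≈ψ =
    Δ-cong A (Unique-++⁻ˡ (labels A) uAB) λ {A₁} {A₂} A₁A₂↭A →
    Δ-cong B (Unique-++⁻ʳ (labels A) uAB) λ {B₁} {B₂} B₁B₂↭B →
    let u′ = Unique-interchange (labels A₁) (labels A₂) (labels B₁)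
               (Unique-resp-↭ (↭-sym (↭.++⁺ A₁A₂↭A B₁B₂↭B)) uAB)
    in φ≈ψ (Unique-++⁻ˡ (labels A₁ ++ labels B₁) u′) (Unique-++⁻ʳ (labels A₁ ++ labels B₁) u′)

  LeftCounital RightCounital : Forest → Set (c ⊔ ℓ)
  LeftCounital  F = ∀ (g : Forest → Carrier) → ∑[ G ⊗ H ∈ Δ F ] ε G * g H ≈ g F
  RightCounital F = ∀ (g : Forest → Carrier) → ∑[ G ⊗ H ∈ Δ F ] ε H * g G ≈ g F

  left-counital : ∀ F → Unique (labels F) → LeftCounital F
  left-counital = forest-induction LeftCounital unit-case gen-case B⁺-case ⋄-case
    where
    unit-case : LeftCounital 𝟙
    unit-case g = trans (Δ-𝟙 _) (*-identityˡ (g 𝟙))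

    gen-case : ∀ x → LeftCounital (gen x)
    gen-case x g = begin
      ∑[ G ⊗ H ∈ Δ (gen x) ] ε G * g H  ≈⟨ Δ-gen x _ ⟩
      0# * g 𝟙 + 1# * g (gen x)         ≈⟨ +-cong (zeroˡ _) (*-identityˡ _) ⟩
      0# + g (gen x)                    ≈⟨ +-identityˡ _ ⟩
      g (gen x)                         ∎

    B⁺-case : ∀ G → Unique (labels G) → LeftCounital G → LeftCounital (B⁺ G)
    B⁺-case G uG counit-G g = begin
      ∑[ G′ ⊗ H ∈ Δ (B⁺ G) ] ε G′ * g H                        ≈⟨ Δ-B⁺ G uG _ ⟩
      ∑[ G₁ ⊗ G₂ ∈ Δ G ] 0# * g G₂ + ε G₁ * (1# * g (B⁺ G₂))  ≈⟨ ∑-cong (Δ G) (λ _ → trans (+-congʳ (zeroˡ _))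
                                                                    (trans (+-identityˡ _) (*-congˡ (*-identityˡ _)))) ⟩
      ∑[ G₁ ⊗ G₂ ∈ Δ G ] ε G₁ * g (B⁺ G₂)                     ≈⟨ counit-G (λ H → g (B⁺ H)) ⟩
      g (B⁺ G)                                                ∎

    ⋄-case : ∀ A B F → Unique (labels A ++ labels B) → A ⋄ B ≡ η F →
             LeftCounital A → LeftCounital B → LeftCounital F
    ⋄-case A B F uAB A⋄B≡F counit-A counit-B g = begin
      ∑[ G ⊗ H ∈ Δ F ] ε G * g H                                          ≈⟨ Δ-factor A B F uAB A⋄B≡F _ ⟩
      ∑[ p ∈ Δ A ] ∑[ q ∈ Δ B ] ⋄₂ᵀ (uncurry λ X Y → ε X * g Y) p q        ≈⟨ ∑-cong (Δ A) (λ p →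
                                                                             trans (∑-cong (Δ B) (⋄₂ᵀ-ε⊗id g p)) (∑-*ˡ (Δ B) _ _)) ⟩
      ∑[ A₁ ⊗ A₂ ∈ Δ A ] ε A₁ * (∑[ B₁ ⊗ B₂ ∈ Δ B ] ε B₁ * ∑ (A₂ ⋄ B₂) g)  ≈⟨ counit-A _ ⟩
      ∑[ B₁ ⊗ B₂ ∈ Δ B ] ε B₁ * ∑ (A ⋄ B₂) g                               ≈⟨ counit-B _ ⟩
      ∑ (A ⋄ B) g                                                          ≈⟨ ∑-≡η A⋄B≡F g ⟩
      g F                                                                  ∎

  right-counital : ∀ F → Unique (labels F) → RightCounital F
  right-counital = forest-induction RightCounital unit-case gen-case B⁺-case ⋄-case
    where
    unit-case : RightCounital 𝟙
    unit-case g = trans (Δ-𝟙 _) (*-identityˡ (g 𝟙))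

    gen-case : ∀ x → RightCounital (gen x)
    gen-case x g = begin
      ∑[ G ⊗ H ∈ Δ (gen x) ] ε H * g G  ≈⟨ Δ-gen x _ ⟩
      1# * g (gen x) + 0# * g 𝟙         ≈⟨ +-cong (*-identityˡ _) (zeroˡ _) ⟩
      g (gen x) + 0#                    ≈⟨ +-identityʳ _ ⟩
      g (gen x)                         ∎

    B⁺-case : ∀ G → Unique (labels G) → RightCounital G → RightCounital (B⁺ G)
    B⁺-case G uG counit-G g = begin
      ∑[ G′ ⊗ H ∈ Δ (B⁺ G) ] ε H * g G′                        ≈⟨ Δ-B⁺ G uG _ ⟩
      ∑[ G₁ ⊗ G₂ ∈ Δ G ] ε G₂ * g (B⁺ G₁) + ε G₁ * (0# * g 𝟙)  ≈⟨ ∑-cong (Δ G) (λ _ → trans (+-congˡ (trans (*-congˡ (zeroˡ _))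
                                                                    (zeroʳ _))) (+-identityʳ _)) ⟩
      ∑[ G₁ ⊗ G₂ ∈ Δ G ] ε G₂ * g (B⁺ G₁)                     ≈⟨ counit-G (λ H → g (B⁺ H)) ⟩
      g (B⁺ G)                                                ∎

    ⋄-case : ∀ A B F → Unique (labels A ++ labels B) → A ⋄ B ≡ η F →
             RightCounital A → RightCounital B → RightCounital F
    ⋄-case A B F uAB A⋄B≡F counit-A counit-B g = begin
      ∑[ G ⊗ H ∈ Δ F ] ε H * g G                                          ≈⟨ Δ-factor A B F uAB A⋄B≡F _ ⟩
      ∑[ p ∈ Δ A ] ∑[ q ∈ Δ B ] ⋄₂ᵀ (uncurry λ X Y → ε Y * g X) p q        ≈⟨ ∑-cong (Δ A) (λ p →
                                                                             trans (∑-cong (Δ B) (⋄₂ᵀ-id⊗ε g p)) (∑-*ˡ (Δ B) _ _)) ⟩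
      ∑[ A₁ ⊗ A₂ ∈ Δ A ] ε A₂ * (∑[ B₁ ⊗ B₂ ∈ Δ B ] ε B₂ * ∑ (A₁ ⋄ B₁) g)  ≈⟨ counit-A _ ⟩
      ∑[ B₁ ⊗ B₂ ∈ Δ B ] ε B₂ * ∑ (A ⋄ B₁) g                               ≈⟨ counit-B _ ⟩
      ∑ (A ⋄ B) g                                                          ≈⟨ ∑-≡η A⋄B≡F g ⟩
      g F                                                                  ∎

  Δ⊗idᵀ id⊗Δᵀ : (Forest³ → Carrier) → Forest × Forest → Carrier
  Δ⊗idᵀ h (G , H) = ∑[ G₁ ⊗ G₂ ∈ Δ G ] h ((G₁ , G₂) , H)
  id⊗Δᵀ h (G , H) = ∑[ H₁ ⊗ H₂ ∈ Δ H ] h ((G , H₁) , H₂)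

  Coassociative : Forest → Set (c ⊔ ℓ)
  Coassociative F = ∀ h → ∑ (Δ F) (Δ⊗idᵀ h) ≈ ∑ (Δ F) (id⊗Δᵀ h)

  R₂ᵀ-Δ⊗idᵀ : ∀ h G₁ G₂ → Unique (labels G₁) → R₂ᵀ (Δ⊗idᵀ h) (G₁ , G₂) ≈ Δ⊗idᵀ (R₃ᵀ h) (G₁ , G₂)
  R₂ᵀ-Δ⊗idᵀ h G₁ G₂ uG₁ = begin
    (∑[ q ∈ Δ (B⁺ G₁) ] h (q , G₂)) + ε G₁ * (∑[ q ∈ Δ 𝟙 ] h (q , B⁺ G₂))
      ≈⟨ +-cong (Δ-B⁺ G₁ uG₁ _) (*-cong (sym (left-counital G₁ uG₁ ε)) (Δ-𝟙 _)) ⟩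
    (∑[ a ∈ Δ G₁ ] R₂ᵀ (λ q → h (q , G₂)) a) + (∑[ a₁ ⊗ a₂ ∈ Δ G₁ ] ε a₁ * ε a₂) * h ((𝟙 , 𝟙) , B⁺ G₂)
      ≈⟨ +-congˡ (∑-*ʳ (Δ G₁) _ _) ⟨
    (∑[ a ∈ Δ G₁ ] R₂ᵀ (λ q → h (q , G₂)) a) + (∑[ a₁ ⊗ a₂ ∈ Δ G₁ ] (ε a₁ * ε a₂) * h ((𝟙 , 𝟙) , B⁺ G₂))
      ≈⟨ ∑-+ (Δ G₁) _ _ ⟨
    ∑[ a₁ ⊗ a₂ ∈ Δ G₁ ] R₂ᵀ (λ q → h (q , G₂)) (a₁ , a₂) + (ε a₁ * ε a₂) * h ((𝟙 , 𝟙) , B⁺ G₂)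
      ≈⟨ ∑-cong (Δ G₁) (λ _ → +-assoc _ _ _) ⟩
    Δ⊗idᵀ (R₃ᵀ h) (G₁ , G₂)
      ∎

  R₂ᵀ-id⊗Δᵀ : ∀ h G₁ G₂ → Unique (labels G₂) → R₂ᵀ (id⊗Δᵀ h) (G₁ , G₂) ≈ id⊗Δᵀ (R₃ᵀ h) (G₁ , G₂)
  R₂ᵀ-id⊗Δᵀ h G₁ G₂ uG₂ = begin
    (∑[ b₁ ⊗ b₂ ∈ Δ G₂ ] h ((B⁺ G₁ , b₁) , b₂)) + ε G₁ * (∑[ b₁ ⊗ b₂ ∈ Δ (B⁺ G₂) ] h ((𝟙 , b₁) , b₂))
      ≈⟨ +-congˡ (*-congˡ (Δ-B⁺ G₂ uG₂ _)) ⟩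
    (∑[ b₁ ⊗ b₂ ∈ Δ G₂ ] h ((B⁺ G₁ , b₁) , b₂))
      + ε G₁ * (∑[ b₁ ⊗ b₂ ∈ Δ G₂ ] h ((𝟙 , B⁺ b₁) , b₂) + ε b₁ * h ((𝟙 , 𝟙) , B⁺ b₂))
      ≈⟨ +-congˡ (∑-*ˡ (Δ G₂) (ε G₁) _) ⟨
    (∑[ b₁ ⊗ b₂ ∈ Δ G₂ ] h ((B⁺ G₁ , b₁) , b₂))
      + (∑[ b₁ ⊗ b₂ ∈ Δ G₂ ] ε G₁ * (h ((𝟙 , B⁺ b₁) , b₂) + ε b₁ * h ((𝟙 , 𝟙) , B⁺ b₂)))
      ≈⟨ ∑-+ (Δ G₂) _ _ ⟨
    ∑[ b₁ ⊗ b₂ ∈ Δ G₂ ] h ((B⁺ G₁ , b₁) , b₂) + ε G₁ * (h ((𝟙 , B⁺ b₁) , b₂) + ε b₁ * h ((𝟙 , 𝟙) , B⁺ b₂))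
      ≈⟨ ∑-cong (Δ G₂) (λ _ → +-congˡ (trans (distribˡ _ _ _) (+-congˡ (sym (*-assoc _ _ _))))) ⟩
    id⊗Δᵀ (R₃ᵀ h) (G₁ , G₂)
      ∎

  Δ⊗idᵀ-B⁺ : ∀ G → Unique (labels G) → ∀ h → ∑ (Δ (B⁺ G)) (Δ⊗idᵀ h) ≈ ∑ (Δ G) (Δ⊗idᵀ (R₃ᵀ h))
  Δ⊗idᵀ-B⁺ G uG h = trans (Δ-B⁺ G uG _) (Δ-cong G uG λ {G₁} {G₂} G₁G₂↭G →
    R₂ᵀ-Δ⊗idᵀ h G₁ G₂ (Unique-++⁻ˡ (labels G₁) (Unique-resp-↭ (↭-sym G₁G₂↭G) uG)))

  id⊗Δᵀ-B⁺ : ∀ G → Unique (labels G) → ∀ h → ∑ (Δ (B⁺ G)) (id⊗Δᵀ h) ≈ ∑ (Δ G) (id⊗Δᵀ (R₃ᵀ h))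
  id⊗Δᵀ-B⁺ G uG h = trans (Δ-B⁺ G uG _) (Δ-cong G uG λ {G₁} {G₂} G₁G₂↭G →
    R₂ᵀ-id⊗Δᵀ h G₁ G₂ (Unique-++⁻ʳ (labels G₁) (Unique-resp-↭ (↭-sym G₁G₂↭G) uG)))

  ⋄₂ᵀ-Δ⊗idᵀ : ∀ h A₁ A₂ B₁ B₂ → Unique (labels A₁ ++ labels B₁) →
              ⋄₂ᵀ (Δ⊗idᵀ h) (A₁ , A₂) (B₁ , B₂) ≈ ∑[ a ∈ Δ A₁ ] ∑[ b ∈ Δ B₁ ] ⋄₃ᵀ h (a , A₂) (b , B₂)
  ⋄₂ᵀ-Δ⊗idᵀ h A₁ A₂ B₁ B₂ uA₁B₁ = begin
    ∑[ X ∈ A₁ ⋄ B₁ ] ∑[ Y ∈ A₂ ⋄ B₂ ] ∑[ q ∈ Δ X ] h (q , Y)  ≈⟨ ∑-cong (A₁ ⋄ B₁) (λ X → ∑-comm (A₂ ⋄ B₂) (Δ X) _) ⟩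
    ∑[ X ∈ A₁ ⋄ B₁ ] ∑[ q ∈ Δ X ] ∑[ Y ∈ A₂ ⋄ B₂ ] h (q , Y)  ≈⟨ Δ-⋄ A₁ B₁ uA₁B₁ _ ⟩
    ∑[ a ∈ Δ A₁ ] ∑[ b ∈ Δ B₁ ] ⋄₃ᵀ h (a , A₂) (b , B₂)       ∎

  ⋄₂ᵀ-id⊗Δᵀ : ∀ h A₁ A₂ B₁ B₂ → Unique (labels A₂ ++ labels B₂) →
              ⋄₂ᵀ (id⊗Δᵀ h) (A₁ , A₂) (B₁ , B₂)
                ≈ ∑[ a₁ ⊗ a₂ ∈ Δ A₂ ] ∑[ b₁ ⊗ b₂ ∈ Δ B₂ ] ⋄₃ᵀ h ((A₁ , a₁) , a₂) ((B₁ , b₁) , b₂)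
  ⋄₂ᵀ-id⊗Δᵀ h A₁ A₂ B₁ B₂ uA₂B₂ = begin
    ∑[ X ∈ A₁ ⋄ B₁ ] ∑[ Y ∈ A₂ ⋄ B₂ ] ∑[ q₁ ⊗ q₂ ∈ Δ Y ] h ((X , q₁) , q₂)
      ≈⟨ ∑-cong (A₁ ⋄ B₁) (λ X → Δ-⋄ A₂ B₂ uA₂B₂ _) ⟩
    ∑[ X ∈ A₁ ⋄ B₁ ] ∑[ a ∈ Δ A₂ ] ∑[ b ∈ Δ B₂ ] ⋄₂ᵀ (uncurry λ q₁ q₂ → h ((X , q₁) , q₂)) a b
      ≈⟨ ∑-comm (A₁ ⋄ B₁) (Δ A₂) _ ⟩
    ∑[ a ∈ Δ A₂ ] ∑[ X ∈ A₁ ⋄ B₁ ] ∑[ b ∈ Δ B₂ ] ⋄₂ᵀ (uncurry λ q₁ q₂ → h ((X , q₁) , q₂)) a b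
      ≈⟨ ∑-cong (Δ A₂) (λ a → ∑-comm (A₁ ⋄ B₁) (Δ B₂) _) ⟩
    ∑[ a ∈ Δ A₂ ] ∑[ b ∈ Δ B₂ ] ∑[ X ∈ A₁ ⋄ B₁ ] ⋄₂ᵀ (uncurry λ q₁ q₂ → h ((X , q₁) , q₂)) a b
      ∎

  Δ⊗idᵀ-⋄ : ∀ A B F → Unique (labels A ++ labels B) → A ⋄ B ≡ η F → ∀ h →
            ∑ (Δ F) (Δ⊗idᵀ h) ≈ ∑ (Δ A) (Δ⊗idᵀ λ T → ∑ (Δ B) (Δ⊗idᵀ (⋄₃ᵀ h T)))
  Δ⊗idᵀ-⋄ A B F uAB A⋄B≡F h = begin
    ∑ (Δ F) (Δ⊗idᵀ h)
      ≈⟨ Δ-factor A B F uAB A⋄B≡F _ ⟩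
    ∑[ p ∈ Δ A ] ∑[ q ∈ Δ B ] ⋄₂ᵀ (Δ⊗idᵀ h) p q
      ≈⟨ Δ⊗Δ-cong A B uAB (λ {A₁} {A₂} {B₁} {B₂} uA₁B₁ _ → ⋄₂ᵀ-Δ⊗idᵀ h A₁ A₂ B₁ B₂ uA₁B₁) ⟩
    ∑[ A₁ ⊗ A₂ ∈ Δ A ] ∑[ B₁ ⊗ B₂ ∈ Δ B ] ∑[ a ∈ Δ A₁ ] ∑[ b ∈ Δ B₁ ] ⋄₃ᵀ h (a , A₂) (b , B₂)
      ≈⟨ ∑-cong (Δ A) (λ p → ∑-comm (Δ B) (Δ (proj₁ p)) _) ⟩
    ∑ (Δ A) (Δ⊗idᵀ λ T → ∑ (Δ B) (Δ⊗idᵀ (⋄₃ᵀ h T)))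
      ∎

  id⊗Δᵀ-⋄ : ∀ A B F → Unique (labels A ++ labels B) → A ⋄ B ≡ η F → ∀ h →
            ∑ (Δ F) (id⊗Δᵀ h) ≈ ∑ (Δ A) (id⊗Δᵀ λ T → ∑ (Δ B) (id⊗Δᵀ (⋄₃ᵀ h T)))
  id⊗Δᵀ-⋄ A B F uAB A⋄B≡F h = begin
    ∑ (Δ F) (id⊗Δᵀ h)
      ≈⟨ Δ-factor A B F uAB A⋄B≡F _ ⟩
    ∑[ p ∈ Δ A ] ∑[ q ∈ Δ B ] ⋄₂ᵀ (id⊗Δᵀ h) p q
      ≈⟨ Δ⊗Δ-cong A B uAB (λ {A₁} {A₂} {B₁} {B₂} _ uA₂B₂ → ⋄₂ᵀ-id⊗Δᵀ h A₁ A₂ B₁ B₂ uA₂B₂) ⟩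
    ∑[ A₁ ⊗ A₂ ∈ Δ A ] ∑[ B₁ ⊗ B₂ ∈ Δ B ] ∑[ a ∈ Δ A₂ ] ∑[ b₁ ⊗ b₂ ∈ Δ B₂ ]
      ⋄₃ᵀ h ((A₁ , proj₁ a) , proj₂ a) ((B₁ , b₁) , b₂)
      ≈⟨ ∑-cong (Δ A) (λ p → ∑-comm (Δ B) (Δ (proj₂ p)) _) ⟩
    ∑ (Δ A) (id⊗Δᵀ λ T → ∑ (Δ B) (id⊗Δᵀ (⋄₃ᵀ h T)))
      ∎

  coassociative : ∀ F → Unique (labels F) → Coassociative F
  coassociative = forest-induction Coassociative unit-case gen-case B⁺-case ⋄-case
    where
    unit-case : Coassociative 𝟙
    unit-case h = begin
      ∑ (Δ 𝟙) (Δ⊗idᵀ h)   ≈⟨ Δ-𝟙 _ ⟩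
      Δ⊗idᵀ h (𝟙 , 𝟙)     ≈⟨ Δ-𝟙 _ ⟩
      h ((𝟙 , 𝟙) , 𝟙)     ≈⟨ Δ-𝟙 _ ⟨
      id⊗Δᵀ h (𝟙 , 𝟙)     ≈⟨ Δ-𝟙 _ ⟨
      ∑ (Δ 𝟙) (id⊗Δᵀ h)   ∎

    gen-case : ∀ x → Coassociative (gen x)
    gen-case x h = begin
      ∑ (Δ (gen x)) (Δ⊗idᵀ h)
        ≈⟨ Δ-gen x _ ⟩
      Δ⊗idᵀ h (gen x , 𝟙) + Δ⊗idᵀ h (𝟙 , gen x)
        ≈⟨ +-cong (Δ-gen x _) (Δ-𝟙 _) ⟩
      (h ((gen x , 𝟙) , 𝟙) + h ((𝟙 , gen x) , 𝟙)) + h ((𝟙 , 𝟙) , gen x)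
        ≈⟨ +-assoc _ _ _ ⟩
      h ((gen x , 𝟙) , 𝟙) + (h ((𝟙 , gen x) , 𝟙) + h ((𝟙 , 𝟙) , gen x))
        ≈⟨ +-cong (Δ-𝟙 _) (Δ-gen x _) ⟨
      id⊗Δᵀ h (gen x , 𝟙) + id⊗Δᵀ h (𝟙 , gen x)
        ≈⟨ Δ-gen x _ ⟨
      ∑ (Δ (gen x)) (id⊗Δᵀ h)
        ∎

    B⁺-case : ∀ G → Unique (labels G) → Coassociative G → Coassociative (B⁺ G)
    B⁺-case G uG coassoc-G h = begin
      ∑ (Δ (B⁺ G)) (Δ⊗idᵀ h)       ≈⟨ Δ⊗idᵀ-B⁺ G uG h ⟩
      ∑ (Δ G) (Δ⊗idᵀ (R₃ᵀ h))      ≈⟨ coassoc-G (R₃ᵀ h) ⟩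
      ∑ (Δ G) (id⊗Δᵀ (R₃ᵀ h))      ≈⟨ id⊗Δᵀ-B⁺ G uG h ⟨
      ∑ (Δ (B⁺ G)) (id⊗Δᵀ h)       ∎

    ⋄-case : ∀ A B F → Unique (labels A ++ labels B) → A ⋄ B ≡ η F →
             Coassociative A → Coassociative B → Coassociative F
    ⋄-case A B F uAB A⋄B≡F coassoc-A coassoc-B h = begin
      ∑ (Δ F) (Δ⊗idᵀ h)                                      ≈⟨ Δ⊗idᵀ-⋄ A B F uAB A⋄B≡F h ⟩
      ∑ (Δ A) (Δ⊗idᵀ λ T → ∑ (Δ B) (Δ⊗idᵀ (⋄₃ᵀ h T)))       ≈⟨ coassoc-A _ ⟩
      ∑ (Δ A) (id⊗Δᵀ λ T → ∑ (Δ B) (Δ⊗idᵀ (⋄₃ᵀ h T)))       ≈⟨ ∑-cong (Δ A) (λ p →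
                                                                 ∑-cong (Δ (proj₂ p)) (λ q → coassoc-B _)) ⟩
      ∑ (Δ A) (id⊗Δᵀ λ T → ∑ (Δ B) (id⊗Δᵀ (⋄₃ᵀ h T)))       ≈⟨ id⊗Δᵀ-⋄ A B F uAB A⋄B≡F h ⟨
      ∑ (Δ F) (id⊗Δᵀ h)                                      ∎

  Δ⊗id id⊗Δ : Forest × Forest → Lin Forest³
  Δ⊗id (G , H) = mapL (λ q → q , H) (Δ G)
  id⊗Δ (G , H) = mapL (λ q → (G , proj₁ q) , proj₂ q) (Δ H)

  ε⊗id id⊗ε : Forest × Forest → Lin Forest
  ε⊗id (G , H) = scale (ε G) (η H)
  id⊗ε (G , H) = scale (ε H) (η G)

  Δ-coassoc : ∀ F → Unique (labels F) → bind (Δ F) Δ⊗id ≈₃ bind (Δ F) id⊗Δ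
  Δ-coassoc F uF = ≃⇒Eq _≟FFF_ {bind (Δ F) Δ⊗id} {bind (Δ F) id⊗Δ} λ h → begin
    ∑ (bind (Δ F) Δ⊗id) h      ≈⟨ ∑-bind (Δ F) Δ⊗id h ⟩
    ∑[ p ∈ Δ F ] ∑ (Δ⊗id p) h  ≈⟨ ∑-cong (Δ F) (λ p → ∑-mapL _ (Δ (proj₁ p)) h) ⟩
    ∑ (Δ F) (Δ⊗idᵀ h)          ≈⟨ coassociative F uF h ⟩
    ∑ (Δ F) (id⊗Δᵀ h)          ≈⟨ ∑-cong (Δ F) (λ p → ∑-mapL _ (Δ (proj₂ p)) h) ⟨
    ∑[ p ∈ Δ F ] ∑ (id⊗Δ p) h  ≈⟨ ∑-bind (Δ F) id⊗Δ h ⟨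
    ∑ (bind (Δ F) id⊗Δ) h      ∎

  Δ-counitˡ : ∀ F → Unique (labels F) → bind (Δ F) ε⊗id ≈₁ η F
  Δ-counitˡ F uF = ≃⇒Eq _≟F_ {bind (Δ F) ε⊗id} {η F} λ g → begin
    ∑ (bind (Δ F) ε⊗id) g       ≈⟨ ∑-bind (Δ F) ε⊗id g ⟩
    ∑[ p ∈ Δ F ] ∑ (ε⊗id p) g   ≈⟨ ∑-cong (Δ F) (λ (G , H) → trans (∑-scale (ε G) (η H) g) (*-congˡ (∑-η H g))) ⟩
    ∑[ G ⊗ H ∈ Δ F ] ε G * g H  ≈⟨ left-counital F uF g ⟩
    g F                         ≈⟨ ∑-η F g ⟨
    ∑ (η F) g                   ∎

  Δ-counitʳ : ∀ F → Unique (labels F) → bind (Δ F) id⊗ε ≈₁ η F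
  Δ-counitʳ F uF = ≃⇒Eq _≟F_ {bind (Δ F) id⊗ε} {η F} λ g → begin
    ∑ (bind (Δ F) id⊗ε) g       ≈⟨ ∑-bind (Δ F) id⊗ε g ⟩
    ∑[ p ∈ Δ F ] ∑ (id⊗ε p) g   ≈⟨ ∑-cong (Δ F) (λ (G , H) → trans (∑-scale (ε H) (η G) g) (*-congˡ (∑-η G g))) ⟩
    ∑[ G ⊗ H ∈ Δ F ] ε H * g G  ≈⟨ right-counital F uF g ⟩
    g F                         ≈⟨ ∑-η F g ⟨
    ∑ (η F) g                   ∎

proposition3p10 : ∀ {c ℓ} (K : CommutativeRing c ℓ) → IsField K → CharZero K →
    (λw : CommutativeRing.Carrier K) →
    (Δ : Forest → ADF.Lin K λw (Forest × Forest)) →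
    ADF.IsΔ K λw Δ → ADF.IsTwistedCoalgebra K λw Δ (ADF.ε K λw)
proposition3p10 K _ _ λw Δ isΔ = record
  { Δ-graded  = graded
  ; Δ-natural = natural
  ; e-graded  = ε-vanishes
  ; e-natural = λ σ F _ → ε-relabel (Inverse.to σ) F
  ; coassoc   = Δ-coassoc
  ; counitˡ   = Δ-counitˡ
  ; counitʳ   = Δ-counitʳ
  }
  where
  open ADF.IsΔ isΔ
  open ForestAlgebra K λw
  open Comultiplication K λw Δ isΔ
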